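{- Let $1\le\delta<\Delta$ be integers, $\tilde h:\mathbb{Z}^+\to\mathbb{R}^+$ a positive non-increasing function and $\mathcal{J}(G)=\sum_{u\in V(G)}\tilde h(d_u)$. If $G\in\mathcal{K}_{\delta,\Delta}$, then $G$ is minimal for $\mathcal{J}$ on $\mathfrak{G}^{\Delta+2}_{\delta,\Delta}$. Moreover, if either $\delta$ is even and $\tilde h(\Delta-1)>\tilde h(\Delta)$, or $\delta$ is odd and $\tilde h(\Delta-2)>\tilde h(\Delta-1)>\tilde h(\Delta)$, then a graph $G\in\mathfrak{G}^{\Delta+2}_{\delta,\Delta}$ is minimal for $\mathcal{J}$ on $\mathfrak{G}^{\Delta+2}_{\delta,\Delta}$ if and only if $G\in\mathcal{K}_{\delta,\Delta}$.
   Context: All graphs are finite and simple; $d_u$ is the degree of $u$. $\mathfrak{G}^n_{\delta,\Delta}$ is the family of graphs with $n$ vertices, minimum degree $\delta$ and maximum degree $\Delta$. For $1\le\delta<\Delta$, $\mathcal{K}_{\delta,\Delta}$ is the family of graphs with $\Delta+2$ vertices, one of which has degree $\delta$, and such that: if $\delta$ is even, the other $\Delta+1$ vertices have degree $\Delta$; if $\delta$ is odd, $\Delta$ of the other vertices have degree $\Delta$ and the last vertex has degree $\Delta-1$. A graph $G$ in a family $\mathcal{F}$ is minimal for $\mathcal{J}$ on $\mathcal{F}$ if $\mathcal{J}(G)\le\mathcal{J}(\Gamma)$ for all $\Gamma\in\mathcal{F}$. -}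

module Defs where

open import Level using (0ℓ)
open import Data.Nat using (ℕ; suc; _+_; _∸_; _≤_; _<_)
open import Data.Nat.Divisibility using (_∣_)
open import Data.Bool using (Bool; true; false)
open import Data.Fin using (Fin)
open import Data.List using (List; length; filterᵇ; foldr; map; allFin)
open import Data.Product using (Σ; _×_; ∃-syntax)
open import Relation.Nullary using (¬_)
open import Relation.Binary.PropositionalEquality using (_≡_; _≢_)
open import Relation.Binary.Structures using (IsTotalOrder)
open import Algebra.Structures using (IsAbelianGroup)

-- Value domain for the weight function h̃.
-- The paper uses ℝ (values in ℝ⁺).  agda-stdlib has no reals, so we
-- quantify over every totally ordered abelian group (with propositional
-- equality); ℝ with + and ≤ is one such.

record OrdAbGroup : Set₁ where
  field
    Carrier : Set
    _+ᴿ_    : Carrier → Carrier → Carrier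
    0ᴿ      : Carrier
    -ᴿ_     : Carrier → Carrier
    _≤ᴿ_    : Carrier → Carrier → Set
    isAbelianGroup : IsAbelianGroup _≡_ _+ᴿ_ 0ᴿ -ᴿ_
    isTotalOrder   : IsTotalOrder _≡_ _≤ᴿ_
    +-monoˡ-≤      : ∀ {x y} z → x ≤ᴿ y → (x +ᴿ z) ≤ᴿ (y +ᴿ z)

  _<ᴿ_ : Carrier → Carrier → Set
  x <ᴿ y = (x ≤ᴿ y) × (x ≢ y)

record Graph (n : ℕ) : Set where
  field
    adj   : Fin n → Fin n → Bool
    sym   : ∀ u v → adj u v ≡ adj v u
    irref : ∀ u → adj u u ≡ false

open Graph public

deg : ∀ {n} → Graph n → Fin n → ℕ
deg {n} G u = length (filterᵇ (adj G u) (allFin n))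

MinDeg : ∀ {n} → Graph n → ℕ → Set
MinDeg {n} G δ = (∀ u → δ ≤ deg G u) × (∃[ u ] deg G u ≡ δ)

MaxDeg : ∀ {n} → Graph n → ℕ → Set
MaxDeg {n} G Δ = (∀ u → deg G u ≤ Δ) × (∃[ u ] deg G u ≡ Δ)

-- G ∈ 𝔊ⁿ_{δ,Δ}  (n is fixed by the type Graph n)
InFamily : ∀ {n} → ℕ → ℕ → Graph n → Set
InFamily δ Δ G = MinDeg G δ × MaxDeg G Δ

Even : ℕ → Set
Even n = 2 ∣ n

Odd : ℕ → Set
Odd n = ¬ Even n

InK : (δ Δ : ℕ) → Graph (Δ + 2) → Set
InK δ Δ G =
  Σ (Fin (Δ + 2)) λ w → (deg G w ≡ δ) ×
    ( (Even δ → ∀ u → u ≢ w → deg G u ≡ Δ)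
    × (Odd δ → Σ (Fin (Δ + 2)) λ x → (x ≢ w) × (deg G x ≡ Δ ∸ 1)
                 × (∀ u → u ≢ w → u ≢ x → deg G u ≡ Δ)) )

module _ (A : OrdAbGroup) where
  open OrdAbGroup A

  𝒥 : ∀ {n} → (ℕ → Carrier) → Graph n → Carrier
  𝒥 {n} h G = foldr _+ᴿ_ 0ᴿ (map (λ u → h (deg G u)) (allFin n))

  PositiveOnℤ⁺ : (ℕ → Carrier) → Set
  PositiveOnℤ⁺ h = ∀ k → 1 ≤ k → 0ᴿ <ᴿ h k

  NonIncrOnℤ⁺ : (ℕ → Carrier) → Set
  NonIncrOnℤ⁺ h = ∀ i j → 1 ≤ i → i ≤ j → h j ≤ᴿ h i

  Minimal : ∀ {n} → (ℕ → Carrier) → ℕ → ℕ → Graph n → Set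
  Minimal {n} h δ Δ G = ∀ (Γ : Graph n) → InFamily δ Δ Γ → 𝒥 h G ≤ᴿ 𝒥 h Γ

-- Let ε ∈ {0, 1} be the parity of δ. The members of 𝒦_{δ,Δ} are exactly the graphs on Δ + 2
-- vertices whose degrees follow the profile "δ at a vertex w, Δ − ε at a vertex x ≠ w, Δ
-- elsewhere". Any Γ in the family has a vertex w of degree δ and all degrees at most Δ; if δ is
-- odd, the handshake lemma forbids all other degrees from being Δ (the degree sum would be
-- δ + (Δ + 1)Δ, which is odd), so some x ≠ w has degree at most Δ − 1. Hence the degrees of Γ are
-- bounded pointwise by the profile, and as h̃ is non-increasing, 𝒥(Γ) ≥ Σ h̃(profile) = 𝒥(K) for
-- every K ∈ 𝒦. When h̃ drops strictly at Δ and at Δ − ε, equality forces every one of these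
-- pointwise bounds to be attained, i.e. Γ has exactly the profile and lies in 𝒦. Finally 𝒦 is
-- non-empty: it contains the complement of a star with Δ + 1 − δ leaves together with a matching
-- of the remaining vertices (for odd δ the matching also covers one leaf).

module Submission where

open import Level using (0ℓ)
open import Algebra.Bundles using (CommutativeMonoid; Group)
open import Algebra.Structures using (IsAbelianGroup)
import Algebra.Properties.CommutativeMonoid.Sum as CommutativeMonoidSum
import Algebra.Properties.Group as GroupProperties
open import Data.Bool using (Bool; true; false; not; _∧_)
open import Data.Empty using (⊥-elim)
open import Data.Fin using (Fin; zero; suc; toℕ; fromℕ<; punchIn; _≟_)
open import Data.Fin.Properties using (¬∀⟶∃¬; punchInᵢ≢i; toℕ-fromℕ<; toℕ-injective; toℕ<n)
open import Data.List using (foldr; map; tabulate; length; filterᵇ)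
import Data.Nat as ℕ
open import Data.Nat using (ℕ; zero; suc; pred; _+_; _*_; _∸_; _≤_; _<_; z≤n; s≤s; s≤s⁻¹; _≤?_; _<?_)
open import Data.Nat.Divisibility using (_∣_; _∣?_; divides; m∣m*n; ∣m∣n⇒∣m+n; ∣m+n∣m⇒∣n; ∣1⇒≡1)
open import Data.Nat.Properties
  using ( +-0-commutativeMonoid; +-identityʳ; +-assoc; +-comm; +-suc; +-cancelʳ-≡; +-cancelʳ-<
        ; +-monoˡ-≤; +-monoˡ-<; ≤-refl; ≤-reflexive; ≤-trans; ≤-antisym; ≤-<-trans; <⇒≤; <⇒≱; ≰⇒>; ≮⇒≥
        ; ≤∧≢⇒<; <-irrefl; n≤1+n; m≤m+n; m≤n+m; m<m+n; n≢0⇒n>0; m≤n⇒∃[o]m+o≡n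
        ; 0∸n≡0; m∸n≤m; m+n∸n≡m; m∸n+n≡m; ∸-monoˡ-≤; ∸-+-assoc )
open import Data.Nat.Tactic.RingSolver using (solve-∀)
open import Data.Product using (Σ; ∃; ∃-syntax; _×_; _,_; proj₁; proj₂)
open import Data.Sum as Sum using (_⊎_; inj₁; inj₂)
open import Data.Vec.Functional using (Vector; updateAt; removeAt; replicate)
open import Data.Vec.Functional.Properties using (updateAt-updates; updateAt-minimal)
open import Function using (_∘_; id; const; case_of_)
open import Function.Bundles using (_⇔_; mk⇔; Equivalence)
open import Function.Properties.Equivalence using () renaming (trans to ⇔-trans)
open import Relation.Binary.Bundles using (Poset)
open import Relation.Binary.Core using (Rel)
open import Relation.Binary.Definitions using (Decidable; Symmetric)
open import Relation.Binary.PropositionalEquality as ≡ using (_≡_; _≢_; _≗_; refl; cong; cong₂)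
import Relation.Binary.Reasoning.PartialOrder as PartialOrderReasoning
open import Relation.Binary.Structures using (IsTotalOrder)
open import Relation.Nullary using (¬_; Dec; yes; no; does)
import Relation.Nullary.Decidable as Dec
open import Relation.Nullary.Decidable using (dec-true; dec-false; does-≡; _⊎-dec_; _×-dec_)
open import Relation.Unary as U using (Pred)

open import Defs hiding (sym)

-- Finite sums

module SumProperties {c ℓ} (M : CommutativeMonoid c ℓ) where
  open CommutativeMonoid M
  open CommutativeMonoidSum M public
  open import Relation.Binary.Reasoning.Setoid setoid

  ∑-updateAt : ∀ {b} {B : Set b} {n} (f : B → Carrier) (v : Vector B n) i (g : B → B) →
               sum (f ∘ updateAt v i g) ∙ f (v i) ≈ f (g (v i)) ∙ sum (f ∘ v)
  ∑-updateAt {n = suc n} f v i g = begin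
    sum (f ∘ updateAt v i g) ∙ f (v i)         ≈⟨ ∙-congʳ (sum-remove {i = i} (f ∘ updateAt v i g)) ⟩
    (f (updateAt v i g i) ∙ rest) ∙ f (v i)    ≡⟨ cong (λ y → (f y ∙ rest) ∙ f (v i)) (updateAt-updates i v) ⟩
    (f (g (v i)) ∙ rest) ∙ f (v i)             ≈⟨ assoc _ _ _ ⟩
    f (g (v i)) ∙ (rest ∙ f (v i))             ≈⟨ ∙-congˡ (comm _ _) ⟩
    f (g (v i)) ∙ (f (v i) ∙ rest)             ≡⟨ cong (λ r → f (g (v i)) ∙ (f (v i) ∙ r)) untouched ⟩
    f (g (v i)) ∙ (f (v i) ∙ sum (removeAt (f ∘ v) i)) ≈⟨ ∙-congˡ (sym (sum-remove (f ∘ v))) ⟩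
    f (g (v i)) ∙ sum (f ∘ v)                  ∎
    where
    rest : Carrier
    rest = sum (removeAt (f ∘ updateAt v i g) i)
    untouched : rest ≡ sum (removeAt (f ∘ v) i)
    untouched = sum-cong-≗ (λ j → cong f (updateAt-minimal (punchIn i j) i v (punchInᵢ≢i i j)))

module ℕSum = SumProperties +-0-commutativeMonoid

sum-replicate≡* : ∀ n x → ℕSum.sum (replicate n x) ≡ n * x
sum-replicate≡* zero    x = refl
sum-replicate≡* (suc n) x = cong (x +_) (sum-replicate≡* n x)

module OrderedSum (A : OrdAbGroup) where
  open OrdAbGroup A renaming (+-monoˡ-≤ to +ᴿ-monoˡ-≤)
  open IsAbelianGroup isAbelianGroup using (comm; isGroup; isCommutativeMonoid)
  open IsTotalOrder isTotalOrder using (antisym) renaming (refl to ≤ᴿ-refl; trans to ≤ᴿ-trans)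

  commutativeMonoid : CommutativeMonoid 0ℓ 0ℓ
  commutativeMonoid = record { isCommutativeMonoid = isCommutativeMonoid }

  group : Group 0ℓ 0ℓ
  group = record { isGroup = isGroup }

  poset : Poset 0ℓ 0ℓ 0ℓ
  poset = record { isPartialOrder = IsTotalOrder.isPartialOrder isTotalOrder }

  open SumProperties commutativeMonoid public using (sum; sum-cong-≗; ∑-updateAt)
  open SumProperties commutativeMonoid using (sum-remove)
  open GroupProperties group public using () renaming (∙-cancelʳ to +ᴿ-cancelʳ)

  +ᴿ-monoʳ-≤ : ∀ z {x y} → x ≤ᴿ y → (z +ᴿ x) ≤ᴿ (z +ᴿ y)
  +ᴿ-monoʳ-≤ z {x} {y} x≤y = ≡.subst₂ _≤ᴿ_ (comm x z) (comm y z) (+ᴿ-monoˡ-≤ z x≤y)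

  +ᴿ-mono-≤ : ∀ {x y u v} → x ≤ᴿ y → u ≤ᴿ v → (x +ᴿ u) ≤ᴿ (y +ᴿ v)
  +ᴿ-mono-≤ {y = y} {u} x≤y u≤v = ≤ᴿ-trans (+ᴿ-monoˡ-≤ u x≤y) (+ᴿ-monoʳ-≤ y u≤v)

  ∑-mono-≤ : ∀ {n} {f g : Vector Carrier n} → (∀ i → f i ≤ᴿ g i) → sum f ≤ᴿ sum g
  ∑-mono-≤ {zero}  f≤g = ≤ᴿ-refl
  ∑-mono-≤ {suc n} f≤g = +ᴿ-mono-≤ (f≤g zero) (∑-mono-≤ (f≤g ∘ suc))

  -- Cancelling the sums of the other entries pins down the entry at i.
  ∑-squeeze : ∀ {n} {f g : Vector Carrier n} → (∀ i → f i ≤ᴿ g i) → sum g ≤ᴿ sum f → f ≗ g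
  ∑-squeeze {suc n} {f} {g} f≤g ∑g≤∑f i =
    +ᴿ-cancelʳ (sum (removeAt f i)) (f i) (g i) (antisym (+ᴿ-monoˡ-≤ _ (f≤g i)) g≤f)
    where
    open PartialOrderReasoning poset
    g≤f : (g i +ᴿ sum (removeAt f i)) ≤ᴿ (f i +ᴿ sum (removeAt f i))
    g≤f = begin
      g i +ᴿ sum (removeAt f i) ≤⟨ +ᴿ-monoʳ-≤ (g i) (∑-mono-≤ (f≤g ∘ punchIn i)) ⟩
      g i +ᴿ sum (removeAt g i) ≡⟨ ≡.sym (sum-remove g) ⟩
      sum g                     ≤⟨ ∑g≤∑f ⟩
      sum f                     ≡⟨ sum-remove f ⟩
      f i +ᴿ sum (removeAt f i) ∎

  foldr-map-tabulate : ∀ {B : Set} {n} (φ : B → Carrier) (g : Fin n → B) →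
                       foldr _+ᴿ_ 0ᴿ (map φ (tabulate g)) ≡ sum (φ ∘ g)
  foldr-map-tabulate {n = zero}  φ g = refl
  foldr-map-tabulate {n = suc n} φ g = cong (φ (g zero) +ᴿ_) (foldr-map-tabulate φ (g ∘ suc))

2∣n+n : ∀ n → 2 ∣ n + n
2∣n+n n = ≡.subst (λ m → 2 ∣ n + m) (+-identityʳ n) (m∣m*n n)

even-or-odd : ∀ n → (∃[ q ] n ≡ q + q) ⊎ (∃[ q ] n ≡ suc (q + q))
even-or-odd zero = inj₁ (0 , refl)
even-or-odd (suc n) with even-or-odd n
... | inj₁ (q , refl) = inj₂ (q , refl)
... | inj₂ (q , refl) = inj₁ (suc q , cong suc (≡.sym (+-suc q q)))

odd-1+q+q : ∀ q → Odd (suc (q + q))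
odd-1+q+q q 2∣1+q+q =
  case ∣1⇒≡1 (∣m+n∣m⇒∣n (≡.subst (2 ∣_) (+-comm 1 (q + q)) 2∣1+q+q) (2∣n+n q)) of λ ()

data Parity (δ : ℕ) : ℕ → Set where
  even : Even δ → Parity δ 0
  odd  : Odd δ → Parity δ 1

parity : ∀ δ → ∃ (Parity δ)
parity δ with 2 ∣? δ
... | yes 2∣δ = 0 , even 2∣δ
... | no  2∤δ = 1 , odd 2∤δ

2∣n*[1+n] : ∀ n → 2 ∣ n * suc n
2∣n*[1+n] zero    = divides 0 refl
2∣n*[1+n] (suc n) = ≡.subst (2 ∣_) (step n) (∣m∣n⇒∣m+n (2∣n*[1+n] n) (2∣n+n (suc n)))
  where
  step : ∀ n → n * suc n + (suc n + suc n) ≡ suc n * suc (suc n)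
  step = solve-∀

<⇒≤∸1 : ∀ {m n} → m < n → m ≤ n ∸ 1
<⇒≤∸1 {n = suc n} (s≤s m≤n) = m≤n

-- Counting and degrees

𝟙 : Bool → ℕ
𝟙 true  = 1
𝟙 false = 0

count : ∀ {n} → Vector Bool n → ℕ
count p = ℕSum.sum (𝟙 ∘ p)

count-false : ∀ n → count {n} (λ _ → false) ≡ 0
count-false zero    = refl
count-false (suc n) = count-false n

count-true : ∀ n → count {n} (λ _ → true) ≡ n
count-true zero    = refl
count-true (suc n) = cong suc (count-true n)

count-≟ : ∀ {n} (u : Fin n) → count (λ v → does (u ≟ v)) ≡ 1
count-≟ {suc n} zero    = cong suc (count-false n)
count-≟         (suc u) = count-≟ u

length-filterᵇ-tabulate : ∀ {B : Set} {n} (p : B → Bool) (f : Fin n → B) →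
                          length (filterᵇ p (tabulate f)) ≡ count (p ∘ f)
length-filterᵇ-tabulate {n = zero}  p f = refl
length-filterᵇ-tabulate {n = suc n} p f with p (f zero)
... | true  = cong suc (length-filterᵇ-tabulate p (f ∘ suc))
... | false = length-filterᵇ-tabulate p (f ∘ suc)

deg≡count : ∀ {n} (G : Graph n) u → deg G u ≡ count (adj G u)
deg≡count G u = length-filterᵇ-tabulate (adj G u) id

∑count-even : ∀ {n} (a : Fin n → Fin n → Bool) → (∀ u v → a u v ≡ a v u) → (∀ u → a u u ≡ false) →
              2 ∣ ℕSum.sum (count ∘ a)
∑count-even {zero}  a a-sym a-irr = divides 0 refl
∑count-even {suc n} a a-sym a-irr =
  ≡.subst (2 ∣_) (≡.sym split)
    (∣m∣n⇒∣m+n (2∣n+n X) (∑count-even a′ (λ u v → a-sym (suc u) (suc v)) (a-irr ∘ suc)))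
  where
  a′ : Fin n → Fin n → Bool
  a′ u v = a (suc u) (suc v)
  X R : ℕ
  X = count (a zero ∘ suc)
  R = ℕSum.sum (count ∘ a′)
  split : ℕSum.sum (count ∘ a) ≡ (X + X) + R
  split = begin
    (𝟙 (a zero zero) + X) + ℕSum.sum (λ u → 𝟙 (a (suc u) zero) + count (a′ u))
      ≡⟨ cong₂ _+_ (cong (λ b → 𝟙 b + X) (a-irr zero))
                   (ℕSum.∑-distrib-+ (λ u → 𝟙 (a (suc u) zero)) (count ∘ a′)) ⟩
    X + (ℕSum.sum (λ u → 𝟙 (a (suc u) zero)) + R)
      ≡⟨ cong (λ s → X + (s + R)) (ℕSum.sum-cong-≗ (λ u → cong 𝟙 (a-sym (suc u) zero))) ⟩
    X + (X + R)
      ≡⟨ ≡.sym (+-assoc X X R) ⟩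
    (X + X) + R ∎
    where open ≡.≡-Reasoning

handshake : ∀ {n} (G : Graph n) → 2 ∣ ℕSum.sum (deg G)
handshake G = ≡.subst (2 ∣_) (ℕSum.sum-cong-≗ (≡.sym ∘ deg≡count G)) (∑count-even (adj G) (Graph.sym G) (irref G))

does-⇔ : ∀ {a b} {P : Set a} {Q : Set b} → P ⇔ Q → (P? : Dec P) (Q? : Dec Q) → does P? ≡ does Q?
does-⇔ P⇔Q P? Q? = does-≡ (Dec.map P⇔Q P?) Q?

fromRelation : ∀ {n} {R : Rel ℕ 0ℓ} → Decidable R → Symmetric R → (∀ i → ¬ R i i) → Graph n
fromRelation R? R-sym R-irr = record
  { adj   = λ u v → does (R? (toℕ u) (toℕ v))
  ; sym   = λ u v → does-⇔ (mk⇔ R-sym R-sym) (R? (toℕ u) (toℕ v)) (R? (toℕ v) (toℕ u))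
  ; irref = λ u → dec-false (R? (toℕ u) (toℕ u)) (R-irr (toℕ u))
  }

complement : ∀ {n} → Graph n → Graph n
complement G = record
  { adj   = λ u v → not (does (u ≟ v)) ∧ not (adj G u v)
  ; sym   = λ u v → cong₂ (λ e a → not e ∧ not a)
                          (does-⇔ (mk⇔ ≡.sym ≡.sym) (u ≟ v) (v ≟ u)) (Graph.sym G u v)
  ; irref = λ u → cong (λ e → not e ∧ not (adj G u u)) (dec-true (u ≟ u) refl)
  }

deg-complement : ∀ {n} (G : Graph n) u → deg (complement G) u + (deg G u + 1) ≡ n
deg-complement {n} G u = begin
  deg (complement G) u + (deg G u + 1)
    ≡⟨ cong₂ (λ d d′ → d + (d′ + 1)) (deg≡count (complement G) u) (deg≡count G u) ⟩
  count c + (count a + 1)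
    ≡⟨ cong (λ d → count c + (count a + d)) (≡.sym (count-≟ u)) ⟩
  count c + (count a + count e)
    ≡⟨ cong (count c +_) (≡.sym (ℕSum.∑-distrib-+ (𝟙 ∘ a) (𝟙 ∘ e))) ⟩
  count c + ℕSum.sum (λ v → 𝟙 (a v) + 𝟙 (e v))
    ≡⟨ ≡.sym (ℕSum.∑-distrib-+ (𝟙 ∘ c) _) ⟩
  ℕSum.sum (λ v → 𝟙 (c v) + (𝟙 (a v) + 𝟙 (e v)))
    ≡⟨ ℕSum.sum-cong-≗ partition ⟩
  count {n} (λ _ → true)
    ≡⟨ count-true n ⟩
  n ∎
  where
  open ≡.≡-Reasoning
  c a e : Vector Bool n
  c = adj (complement G) u
  a = adj G u
  e = λ v → does (u ≟ v)
  partition : ∀ v → 𝟙 (c v) + (𝟙 (a v) + 𝟙 (e v)) ≡ 1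
  partition v with u ≟ v
  ... | yes refl rewrite irref G u = refl
  ... | no _ with a v
  ...   | true  = refl
  ...   | false = refl

countBelow : ∀ {P : Pred ℕ 0ℓ} → U.Decidable P → ℕ → ℕ
countBelow P? n = count {n} (λ i → does (P? (toℕ i)))

countBelow-none : ∀ {P : Pred ℕ 0ℓ} (P? : U.Decidable P) n → (∀ j → ¬ P j) → countBelow P? n ≡ 0
countBelow-none P? zero    ¬P = refl
countBelow-none P? (suc n) ¬P rewrite dec-false (P? 0) (¬P 0) = countBelow-none (P? ∘ suc) n (¬P ∘ suc)

suc∈interval⇔ : ∀ lo {hi j} → (lo ≤ suc j × suc j < suc hi) ⇔ (pred lo ≤ j × j < hi)
suc∈interval⇔ zero     = mk⇔ (λ (_ , j<hi) → z≤n , s≤s⁻¹ j<hi) (λ (_ , j<hi) → z≤n , s≤s j<hi)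
suc∈interval⇔ (suc lo) = mk⇔ (λ (lo≤j , j<hi) → s≤s⁻¹ lo≤j , s≤s⁻¹ j<hi)
                             (λ (lo≤j , j<hi) → s≤s lo≤j , s≤s j<hi)

countBelow-interval : ∀ {P : Pred ℕ 0ℓ} (P? : U.Decidable P) {lo hi} n →
                      (∀ j → P j ⇔ (lo ≤ j × j < hi)) → hi ≤ n → countBelow P? n ≡ hi ∸ lo
countBelow-interval P? {lo} {zero} n P⇔ _ =
  ≡.trans (countBelow-none P? n (λ j Pj → case proj₂ (Equivalence.to (P⇔ j) Pj) of λ ())) (≡.sym (0∸n≡0 lo))
countBelow-interval P? {zero} {suc hi} (suc n) P⇔ (s≤s hi≤n) with P? 0
... | yes _   = cong suc (countBelow-interval (P? ∘ suc) n (λ j → ⇔-trans (P⇔ (suc j)) (suc∈interval⇔ zero)) hi≤n)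
... | no ¬P₀  = ⊥-elim (¬P₀ (Equivalence.from (P⇔ 0) (z≤n , s≤s z≤n)))
countBelow-interval P? {suc lo} {suc hi} (suc n) P⇔ (s≤s hi≤n) with P? 0
... | yes P₀  = case proj₁ (Equivalence.to (P⇔ 0) P₀) of λ ()
... | no _    = countBelow-interval (P? ∘ suc) n (λ j → ⇔-trans (P⇔ (suc j)) (suc∈interval⇔ (suc lo))) hi≤n

countBelow-single : ∀ {P : Pred ℕ 0ℓ} (P? : U.Decidable P) {c} n →
                    (∀ j → P j ⇔ j ≡ c) → c < n → countBelow P? n ≡ 1
countBelow-single P? {c} n P⇔ c<n =
  ≡.trans (countBelow-interval P? n (λ j → ⇔-trans (P⇔ j) ≡⇔interval) c<n) (m+n∸n≡m 1 c)
  where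
  ≡⇔interval : ∀ {j} → j ≡ c ⇔ (c ≤ j × j < suc c)
  ≡⇔interval = mk⇔ (λ { refl → ≤-refl , ≤-refl }) (λ (c≤j , j<1+c) → ≤-antisym (s≤s⁻¹ j<1+c) c≤j)

countBelow-⊎ : ∀ {P Q : Pred ℕ 0ℓ} (P? : U.Decidable P) (Q? : U.Decidable Q) n → (∀ j → P j → ¬ Q j) →
               countBelow (λ j → P? j ⊎-dec Q? j) n ≡ countBelow P? n + countBelow Q? n
countBelow-⊎ P? Q? n disjoint = ≡.trans (ℕSum.sum-cong-≗ split) (ℕSum.∑-distrib-+ {n} _ _)
  where
  split : ∀ (i : Fin n) →
          𝟙 (does (P? (toℕ i) ⊎-dec Q? (toℕ i))) ≡ 𝟙 (does (P? (toℕ i))) + 𝟙 (does (Q? (toℕ i)))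
  split i with P? (toℕ i) | Q? (toℕ i)
  ... | yes p | yes q = ⊥-elim (disjoint _ p q)
  ... | yes _ | no _  = refl
  ... | no _  | yes _ = refl
  ... | no _  | no _  = refl

third-vertex : ∀ {n} → 3 ≤ n → (w x : Fin n) → ∃[ u ] u ≢ w × u ≢ x
third-vertex (s≤s (s≤s (s≤s _))) (suc _)       (suc _)       = zero , (λ ()) , (λ ())
third-vertex (s≤s (s≤s (s≤s _))) zero          zero          = suc zero , (λ ()) , (λ ())
third-vertex (s≤s (s≤s (s≤s _))) zero          (suc zero)    = suc (suc zero) , (λ ()) , (λ ())
third-vertex (s≤s (s≤s (s≤s _))) zero          (suc (suc _)) = suc zero , (λ ()) , (λ ())
third-vertex (s≤s (s≤s (s≤s _))) (suc zero)    zero          = suc (suc zero) , (λ ()) , (λ ())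
third-vertex (s≤s (s≤s (s≤s _))) (suc (suc _)) zero          = suc zero , (λ ()) , (λ ())

toℕ≢ : ∀ {n c} {u : Fin n} .(c<n : c < n) → u ≢ fromℕ< c<n → toℕ u ≢ c
toℕ≢ c<n u≢c toℕu≡c = u≢c (toℕ-injective (≡.trans toℕu≡c (≡.sym (toℕ-fromℕ< c<n))))

-- A member of 𝒦

module StarMatchingComplement (n k a m : ℕ) (n≡a+m+m : n ≡ a + m + m)
                              (1≤a : 1 ≤ a) (k≤a : k ≤ a) (a≤1+k : a ≤ suc k) (1≤m : 1 ≤ m) where

  Spoke Pair Star Matching Edge : Rel ℕ 0ℓ
  Spoke i j    = i ≡ 0 × 1 ≤ j × j ≤ k
  Pair i j     = a ≤ i × i < a + m × j ≡ i + m
  Star i j     = Spoke i j ⊎ Spoke j i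
  Matching i j = Pair i j ⊎ Pair j i
  Edge i j     = Star i j ⊎ Matching i j

  Spoke? : Decidable Spoke
  Spoke? i j = (i ℕ.≟ 0) ×-dec (1 ≤? j) ×-dec (j ≤? k)

  Pair? : Decidable Pair
  Pair? i j = (a ≤? i) ×-dec (i <? a + m) ×-dec (j ℕ.≟ i + m)

  Star? : Decidable Star
  Star? i j = Spoke? i j ⊎-dec Spoke? j i

  Matching? : Decidable Matching
  Matching? i j = Pair? i j ⊎-dec Pair? j i

  Edge? : Decidable Edge
  Edge? i j = Star? i j ⊎-dec Matching? i j

  Edge-sym : Symmetric Edge
  Edge-sym = Sum.map Sum.swap Sum.swap

  Edge-irrefl : ∀ i → ¬ Edge i i
  Edge-irrefl i (inj₁ (inj₁ (refl , () , _)))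
  Edge-irrefl i (inj₁ (inj₂ (refl , () , _)))
  Edge-irrefl i (inj₂ (inj₁ (_ , _ , i≡i+m))) = <-irrefl i≡i+m (m<m+n i 1≤m)
  Edge-irrefl i (inj₂ (inj₂ (_ , _ , i≡i+m))) = <-irrefl i≡i+m (m<m+n i 1≤m)

  a<n : a < n
  a<n = ≡.subst (a <_) (≡.sym n≡a+m+m) (≤-trans (m<m+n a 1≤m) (m≤m+n (a + m) m))

  Star-endpoint : ∀ {i j} → Star i j → i ≡ 0 ⊎ j ≡ 0
  Star-endpoint (inj₁ (i≡0 , _)) = inj₁ i≡0
  Star-endpoint (inj₂ (j≡0 , _)) = inj₂ j≡0

  Matching-endpoints : ∀ {i j} → Matching i j → a ≤ i × a ≤ j
  Matching-endpoints (inj₁ (a≤i , _ , refl)) = a≤i , ≤-trans a≤i (m≤m+n _ m)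
  Matching-endpoints (inj₂ (a≤j , _ , refl)) = ≤-trans a≤j (m≤m+n _ m) , a≤j

  a≰0 : ¬ a ≤ 0
  a≰0 a≤0 = case ≤-trans 1≤a a≤0 of λ ()

  Star-disjoint-Matching : ∀ i j → Star i j → ¬ Matching i j
  Star-disjoint-Matching i j star matching with Star-endpoint star | Matching-endpoints matching
  ... | inj₁ refl | a≤0 , _ = a≰0 a≤0
  ... | inj₂ refl | _ , a≤0 = a≰0 a≤0

  starMatchingDeg : ℕ → ℕ
  starMatchingDeg i = countBelow (Edge? i) n

  starMatchingDeg-split : ∀ i → starMatchingDeg i ≡ countBelow (Star? i) n + countBelow (Matching? i) n
  starMatchingDeg-split i = countBelow-⊎ (Star? i) (Matching? i) n (Star-disjoint-Matching i)

  0<n : 0 < n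
  0<n = ≤-<-trans z≤n a<n

  Star-centre : countBelow (Star? 0) n ≡ k
  Star-centre = countBelow-interval (Star? 0) n (λ _ → mk⇔ to from) (≤-<-trans k≤a a<n)
    where
    to : ∀ {j} → Star 0 j → 1 ≤ j × j < suc k
    to (inj₁ (_ , 1≤j , j≤k)) = 1≤j , s≤s j≤k
    from : ∀ {j} → 1 ≤ j × j < suc k → Star 0 j
    from (1≤j , j<1+k) = inj₁ (refl , 1≤j , s≤s⁻¹ j<1+k)

  Star-leaf : ∀ {i} → 1 ≤ i → i ≤ k → countBelow (Star? i) n ≡ 1
  Star-leaf {i} 1≤i i≤k = countBelow-single (Star? i) n (λ _ → mk⇔ to from) 0<n
    where
    to : ∀ {j} → Star i j → j ≡ 0
    to (inj₁ (refl , _)) = case 1≤i of λ ()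
    to (inj₂ (j≡0 , _))  = j≡0
    from : ∀ {j} → j ≡ 0 → Star i j
    from refl = inj₂ (refl , 1≤i , i≤k)

  Star-far : ∀ {i} → k < i → countBelow (Star? i) n ≡ 0
  Star-far {i} k<i = countBelow-none (Star? i) n λ
    { _ (inj₁ (refl , _))     → case k<i of λ ()
    ; _ (inj₂ (_ , _ , i≤k)) → <⇒≱ k<i i≤k }

  Matching-low : ∀ {i} → i < a → countBelow (Matching? i) n ≡ 0
  Matching-low {i} i<a = countBelow-none (Matching? i) n λ _ matching →
    <⇒≱ i<a (proj₁ (Matching-endpoints matching))

  Matching-matched : ∀ {i} → a ≤ i → i < n → countBelow (Matching? i) n ≡ 1
  Matching-matched {i} a≤i i<n with i <? a + m
  ... | yes i<a+m = countBelow-single (Matching? i) n (λ _ → mk⇔ to from) i+m<n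
    where
    i+m<n : i + m < n
    i+m<n = ≡.subst (i + m <_) (≡.sym n≡a+m+m) (+-monoˡ-< m i<a+m)
    to : ∀ {j} → Matching i j → j ≡ i + m
    to (inj₁ (_ , _ , j≡i+m))   = j≡i+m
    to (inj₂ (a≤j , _ , refl)) = ⊥-elim (<⇒≱ i<a+m (+-monoˡ-≤ m a≤j))
    from : ∀ {j} → j ≡ i + m → Matching i j
    from j≡i+m = inj₁ (a≤i , i<a+m , j≡i+m)
  ... | no i≮a+m = countBelow-single (Matching? i) n (λ _ → mk⇔ to from) (≤-<-trans (m∸n≤m i m) i<n)
    where
    a+m≤i : a + m ≤ i
    a+m≤i = ≮⇒≥ i≮a+m
    m≤i : m ≤ i
    m≤i = ≤-trans (m≤n+m m a) a+m≤i
    to : ∀ {j} → Matching i j → j ≡ i ∸ m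
    to (inj₁ (_ , i<a+m , _))  = ⊥-elim (i≮a+m i<a+m)
    to {j} (inj₂ (_ , _ , refl)) = ≡.sym (m+n∸n≡m j m)
    from : ∀ {j} → j ≡ i ∸ m → Matching i j
    from refl = inj₂ (a≤i∸m , i∸m<a+m , ≡.sym (m∸n+n≡m m≤i))
      where
      a≤i∸m : a ≤ i ∸ m
      a≤i∸m = ≡.subst (_≤ i ∸ m) (m+n∸n≡m a m) (∸-monoˡ-≤ m a+m≤i)
      i∸m<a+m : i ∸ m < a + m
      i∸m<a+m = +-cancelʳ-< m (i ∸ m) (a + m)
                  (≡.subst₂ _<_ (≡.sym (m∸n+n≡m m≤i)) n≡a+m+m i<n)

  starMatchingDeg-centre : starMatchingDeg 0 ≡ k
  starMatchingDeg-centre =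
    ≡.trans (starMatchingDeg-split 0) (≡.trans (cong₂ _+_ Star-centre (Matching-low 1≤a)) (+-identityʳ k))

  starMatchingDeg-regular : ∀ {i} → 1 ≤ i → i < n → (i ≤ k → i < a) → starMatchingDeg i ≡ 1
  starMatchingDeg-regular {i} 1≤i i<n leaf⇒i<a with i ≤? k
  ... | yes i≤k = ≡.trans (starMatchingDeg-split i)
                    (cong₂ _+_ (Star-leaf 1≤i i≤k) (Matching-low (leaf⇒i<a i≤k)))
  ... | no  i≰k = ≡.trans (starMatchingDeg-split i)
                    (cong₂ _+_ (Star-far (≰⇒> i≰k)) (Matching-matched (≤-trans a≤1+k (≰⇒> i≰k)) i<n))

  starMatchingDeg-matchedLeaf : a ≡ k → starMatchingDeg a ≡ 2
  starMatchingDeg-matchedLeaf a≡k = ≡.trans (starMatchingDeg-split a)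
    (cong₂ _+_ (Star-leaf 1≤a (≤-reflexive a≡k)) (Matching-matched ≤-refl a<n))

  starMatching : Graph n
  starMatching = fromRelation Edge? Edge-sym Edge-irrefl

  graph : Graph n
  graph = complement starMatching

  deg-graph : ∀ u {d} → starMatchingDeg (toℕ u) ≡ d → deg graph u + (d + 1) ≡ n
  deg-graph u refl = ≡.subst (λ d → deg graph u + (d + 1) ≡ n)
                       (deg≡count starMatching u) (deg-complement starMatching u)

  centre : Fin n
  centre = fromℕ< 0<n

  deg-centre : deg graph centre + (k + 1) ≡ n
  deg-centre = deg-graph centre (≡.trans (cong starMatchingDeg (toℕ-fromℕ< 0<n)) starMatchingDeg-centre)

  deg-regular : ∀ u → u ≢ centre → (toℕ u ≤ k → toℕ u < a) → deg graph u + 2 ≡ n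
  deg-regular u u≢centre = deg-graph u ∘ starMatchingDeg-regular (n≢0⇒n>0 (toℕ≢ 0<n u≢centre)) (toℕ<n u)

  matchedLeaf : Fin n
  matchedLeaf = fromℕ< a<n

  matchedLeaf≢centre : matchedLeaf ≢ centre
  matchedLeaf≢centre matchedLeaf≡centre =
    a≰0 (≤-reflexive (≡.trans (≡.sym (toℕ-fromℕ< a<n))
                              (≡.trans (cong toℕ matchedLeaf≡centre) (toℕ-fromℕ< 0<n))))

  deg-matchedLeaf : a ≡ k → deg graph matchedLeaf + 3 ≡ n
  deg-matchedLeaf a≡k =
    deg-graph matchedLeaf (≡.trans (cong starMatchingDeg (toℕ-fromℕ< a<n)) (starMatchingDeg-matchedLeaf a≡k))

𝒦-even : ∀ q r → 1 ≤ q → Σ (Graph (suc (q + q) + r + 2)) (InK (q + q) (suc (q + q) + r))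
𝒦-even q r 1≤q =
  graph , centre , deg-centre′ ,
  (λ _ u u≢centre → +-cancelʳ-≡ 2 _ _ (deg-regular u u≢centre s≤s)) ,
  (λ odd → ⊥-elim (odd (2∣n+n q)))
  where
  size : ∀ q r → suc (q + q) + r + 2 ≡ suc (suc (suc r)) + q + q
  size = solve-∀
  open StarMatchingComplement (suc (q + q) + r + 2) (suc (suc r)) (suc (suc (suc r))) q
         (size q r) (s≤s z≤n) (n≤1+n _) ≤-refl 1≤q
  centre-size : ∀ q r → suc (q + q) + r + 2 ≡ q + q + (suc (suc r) + 1)
  centre-size = solve-∀
  deg-centre′ : deg graph centre ≡ q + q
  deg-centre′ = +-cancelʳ-≡ (suc (suc r) + 1) _ _ (≡.trans deg-centre (centre-size q r))

𝒦-odd : ∀ q r → Σ (Graph (suc (suc (q + q)) + r + 2)) (InK (suc (q + q)) (suc (suc (q + q)) + r))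
𝒦-odd q r = graph , centre , deg-centre′ , (λ even → ⊥-elim (odd-1+q+q q even)) ,
            (λ _ → matchedLeaf , matchedLeaf≢centre , deg-matchedLeaf′ , deg-other)
  where
  size : ∀ q r → suc (suc (q + q)) + r + 2 ≡ suc (suc r) + suc q + suc q
  size = solve-∀
  open StarMatchingComplement (suc (suc (q + q)) + r + 2) (suc (suc r)) (suc (suc r)) (suc q)
         (size q r) (s≤s z≤n) ≤-refl (n≤1+n _) (s≤s z≤n)
  centre-size : ∀ q r → suc (suc (q + q)) + r + 2 ≡ suc (q + q) + (suc (suc r) + 1)
  centre-size = solve-∀
  deg-centre′ : deg graph centre ≡ suc (q + q)
  deg-centre′ = +-cancelʳ-≡ (suc (suc r) + 1) _ _ (≡.trans deg-centre (centre-size q r))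
  matchedLeaf-size : ∀ q r → suc (suc (q + q)) + r + 2 ≡ suc (q + q) + r + 3
  matchedLeaf-size = solve-∀
  deg-matchedLeaf′ : deg graph matchedLeaf ≡ suc (q + q) + r
  deg-matchedLeaf′ = +-cancelʳ-≡ 3 _ _ (≡.trans (deg-matchedLeaf refl) (matchedLeaf-size q r))
  deg-other : ∀ u → u ≢ centre → u ≢ matchedLeaf → deg graph u ≡ suc (suc (q + q)) + r
  deg-other u u≢centre u≢matchedLeaf =
    +-cancelʳ-≡ 2 _ _ (deg-regular u u≢centre (λ u≤k → ≤∧≢⇒< u≤k (toℕ≢ a<n u≢matchedLeaf)))

𝒦-nonempty : ∀ {δ Δ} → 1 ≤ δ → δ < Δ → Σ (Graph (Δ + 2)) (InK δ Δ)
𝒦-nonempty {δ} 1≤δ δ<Δ with m≤n⇒∃[o]m+o≡n δ<Δ | even-or-odd δ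
... | r , refl | inj₁ (zero , refl)  = case 1≤δ of λ ()
... | r , refl | inj₁ (suc q , refl) = 𝒦-even (suc q) r (s≤s z≤n)
... | r , refl | inj₂ (q , refl)     = 𝒦-odd q r

-- Degree profiles

module Profiles {δ Δ : ℕ} (δ<Δ : δ < Δ) where

  almostRegular : Fin (Δ + 2) → Vector ℕ (Δ + 2)
  almostRegular w = updateAt (replicate (Δ + 2) Δ) w (const δ)

  profile : ℕ → Fin (Δ + 2) → Fin (Δ + 2) → Vector ℕ (Δ + 2)
  profile ε w x = updateAt (almostRegular w) x (const (Δ ∸ ε))

  module _ (ε : ℕ) {w x : Fin (Δ + 2)} where

    profile-at-x : profile ε w x x ≡ Δ ∸ ε
    profile-at-x = updateAt-updates x (almostRegular w)

    profile-at-w : x ≢ w → profile ε w x w ≡ δ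
    profile-at-w x≢w = ≡.trans (updateAt-minimal w x _ (x≢w ∘ ≡.sym)) (updateAt-updates w _)

    profile-elsewhere : ∀ {u} → u ≢ w → u ≢ x → profile ε w x u ≡ Δ
    profile-elsewhere {u} u≢w u≢x = ≡.trans (updateAt-minimal u x _ u≢x) (updateAt-minimal u w _ u≢w)

    profile-elim : ∀ {p} (P : ℕ → Set p) → x ≢ w → ∀ u →
                   (u ≡ w → P δ) → (u ≡ x → P (Δ ∸ ε)) → (u ≢ w → u ≢ x → P Δ) → P (profile ε w x u)
    profile-elim P x≢w u at-w at-x elsewhere with u ≟ x | u ≟ w
    ... | yes refl | _        = ≡.subst P (≡.sym profile-at-x) (at-x refl)
    ... | no  _    | yes refl = ≡.subst P (≡.sym (profile-at-w x≢w)) (at-w refl)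
    ... | no  u≢x  | no  u≢w  = ≡.subst P (≡.sym (profile-elsewhere u≢w u≢x)) (elsewhere u≢w u≢x)

  3≤Δ+2 : 3 ≤ Δ + 2
  3≤Δ+2 = +-monoˡ-≤ 2 (≤-<-trans z≤n δ<Δ)

  δ≤Δ∸ε : ∀ {ε} → Parity δ ε → δ ≤ Δ ∸ ε
  δ≤Δ∸ε (even _) = <⇒≤ δ<Δ
  δ≤Δ∸ε (odd _)  = <⇒≤∸1 δ<Δ

  InK⇒profile : ∀ {ε} → Parity δ ε → ∀ (G : Graph (Δ + 2)) → InK δ Δ G →
                ∃[ w ] ∃[ x ] x ≢ w × deg G ≗ profile ε w x
  InK⇒profile (even 2∣δ) G (w , dw , regular , _) with third-vertex 3≤Δ+2 w w
  ... | x , x≢w , _ =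
    w , x , x≢w , λ u → profile-elim 0 (deg G u ≡_) x≢w u (λ { refl → dw }) (λ { refl → regular 2∣δ x x≢w })
                                    (λ u≢w _ → regular 2∣δ u u≢w)
  InK⇒profile (odd 2∤δ) G (w , dw , _ , irregular) with irregular 2∤δ
  ... | x , x≢w , dx , regular =
    w , x , x≢w , λ u → profile-elim 1 (deg G u ≡_) x≢w u (λ { refl → dw }) (λ { refl → dx }) (regular u)

  profile⇒InK : ∀ {ε w x} → Parity δ ε → ∀ (G : Graph (Δ + 2)) → x ≢ w → deg G ≗ profile ε w x →
                InK δ Δ G
  profile⇒InK {w = w} (even 2∣δ) G x≢w deg≗ =
    w , ≡.trans (deg≗ w) (profile-at-w 0 x≢w) ,
    (λ _ u u≢w → ≡.trans (deg≗ u)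
                   (profile-elim 0 (_≡ Δ) x≢w u (⊥-elim ∘ u≢w) (λ _ → refl) (λ _ _ → refl))) ,
    (λ 2∤δ → ⊥-elim (2∤δ 2∣δ))
  profile⇒InK {w = w} {x} (odd 2∤δ) G x≢w deg≗ =
    w , ≡.trans (deg≗ w) (profile-at-w 1 x≢w) , (λ 2∣δ → ⊥-elim (2∤δ 2∣δ)) ,
    (λ _ → x , x≢w , ≡.trans (deg≗ x) (profile-at-x 1) ,
           λ u u≢w u≢x → ≡.trans (deg≗ u) (profile-elsewhere 1 u≢w u≢x))

  profile⇒InFamily : ∀ {ε w x} → Parity δ ε → ∀ (G : Graph (Δ + 2)) → x ≢ w → deg G ≗ profile ε w x →
                     InFamily δ Δ G
  profile⇒InFamily {ε} {w} {x} par G x≢w deg≗ with third-vertex 3≤Δ+2 w x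
  ... | v , v≢w , v≢x =
    ( (λ u → ≡.subst (δ ≤_) (≡.sym (deg≗ u)) (proj₁ (bounds u)))
    , w , ≡.trans (deg≗ w) (profile-at-w ε x≢w) ) ,
    ( (λ u → ≡.subst (_≤ Δ) (≡.sym (deg≗ u)) (proj₂ (bounds u)))
    , v , ≡.trans (deg≗ v) (profile-elsewhere ε v≢w v≢x) )
    where
    bounds : ∀ u → δ ≤ profile ε w x u × profile ε w x u ≤ Δ
    bounds u = profile-elim ε (λ d → δ ≤ d × d ≤ Δ) x≢w u (λ _ → ≤-refl , <⇒≤ δ<Δ)
                 (λ _ → δ≤Δ∸ε par , m∸n≤m Δ ε) (λ _ _ → <⇒≤ δ<Δ , ≤-refl)

  almostRegular-even : ∀ (Γ : Graph (Δ + 2)) {w} → deg Γ w ≡ δ → (∀ u → u ≡ w ⊎ deg Γ u ≡ Δ) → Even δ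
  almostRegular-even Γ {w} dw regular = ∣m+n∣m⇒∣n (≡.subst (2 ∣_) ∑deg≡ (handshake Γ)) (2∣n*[1+n] Δ)
    where
    deg≗ : deg Γ ≗ almostRegular w
    deg≗ u with u ≟ w
    ... | yes refl = ≡.trans dw (≡.sym (updateAt-updates w _))
    ... | no  u≢w  = ≡.trans (Sum.[ ⊥-elim ∘ u≢w , id ] (regular u)) (≡.sym (updateAt-minimal u w _ u≢w))
    rearrange : ∀ δ Δ → δ + (Δ + 2) * Δ ≡ Δ * suc Δ + δ + Δ
    rearrange = solve-∀
    ∑deg≡ : ℕSum.sum (deg Γ) ≡ Δ * suc Δ + δ
    ∑deg≡ = +-cancelʳ-≡ Δ _ _ (begin
      ℕSum.sum (deg Γ) + Δ            ≡⟨ cong (_+ Δ) (ℕSum.sum-cong-≗ deg≗) ⟩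
      ℕSum.sum (almostRegular w) + Δ  ≡⟨ ℕSum.∑-updateAt id (replicate (Δ + 2) Δ) w (const δ) ⟩
      δ + ℕSum.sum (replicate (Δ + 2) Δ) ≡⟨ cong (δ +_) (sum-replicate≡* (Δ + 2) Δ) ⟩
      δ + (Δ + 2) * Δ                 ≡⟨ rearrange δ Δ ⟩
      Δ * suc Δ + δ + Δ               ∎)
      where open ≡.≡-Reasoning

  defect : ∀ {ε} → Parity δ ε → ∀ (Γ : Graph (Δ + 2)) → InFamily δ Δ Γ → ∀ w → deg Γ w ≡ δ →
           ∃[ x ] x ≢ w × deg Γ x ≤ Δ ∸ ε
  defect (even _) Γ (_ , ≤Δ , _) w dw =
    let x , x≢w , _ = third-vertex 3≤Δ+2 w w in x , x≢w , ≤Δ x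
  defect (odd 2∤δ) Γ (_ , ≤Δ , _) w dw
    with ¬∀⟶∃¬ (Δ + 2) _ (λ u → (u ≟ w) ⊎-dec (deg Γ u ℕ.≟ Δ)) (2∤δ ∘ almostRegular-even Γ dw)
  ... | x , x∉ = x , x∉ ∘ inj₁ , <⇒≤∸1 (≤∧≢⇒< (≤Δ x) (x∉ ∘ inj₂))

  dominated : ∀ {ε} → Parity δ ε → ∀ (Γ : Graph (Δ + 2)) → InFamily δ Δ Γ →
              ∃[ w ] ∃[ x ] x ≢ w × deg Γ w ≡ δ × (∀ u → deg Γ u ≤ profile ε w x u)
  dominated {ε} par Γ fam@((_ , w , dw) , ≤Δ , _) with defect par Γ fam w dw
  ... | x , x≢w , dx = w , x , x≢w , dw , λ u →
    profile-elim ε (deg Γ u ≤_) x≢w u (λ { refl → ≤-reflexive dw }) (λ { refl → dx }) (λ _ _ → ≤Δ u)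

  𝒦⊆𝔊 : ∀ {ε} → Parity δ ε → ∀ (G : Graph (Δ + 2)) → InK δ Δ G → InFamily δ Δ G
  𝒦⊆𝔊 par G G∈𝒦 = let _ , _ , x≢w , deg≗ = InK⇒profile par G G∈𝒦 in profile⇒InFamily par G x≢w deg≗

-- The minimum of 𝒥

module Minimality (A : OrdAbGroup) {δ Δ : ℕ} (1≤δ : 1 ≤ δ) (δ<Δ : δ < Δ)
                  (h : ℕ → OrdAbGroup.Carrier A) (antitone : NonIncrOnℤ⁺ A h) where
  open OrdAbGroup A
  open OrderedSum A
  open Profiles δ<Δ
  open IsTotalOrder isTotalOrder using (antisym)
  module ≤ᴿ-Reasoning = PartialOrderReasoning poset

  𝒥≡∑ : ∀ (G : Graph (Δ + 2)) → 𝒥 A h G ≡ sum (h ∘ deg G)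
  𝒥≡∑ G = foldr-map-tabulate (h ∘ deg G) id

  1≤deg : ∀ (Γ : Graph (Δ + 2)) → InFamily δ Δ Γ → ∀ u → 1 ≤ deg Γ u
  1≤deg Γ ((δ≤deg , _) , _) u = ≤-trans 1≤δ (δ≤deg u)

  h-antitone-deg : ∀ (Γ : Graph (Δ + 2)) → InFamily δ Δ Γ → ∀ u {d} → deg Γ u ≤ d → h d ≤ᴿ h (deg Γ u)
  h-antitone-deg Γ fam u = antitone _ _ (1≤deg Γ fam u)

  h≡⇒≡ : ∀ {d D} → 1 ≤ d → d ≤ D → h D <ᴿ h (D ∸ 1) → h D ≡ h d → d ≡ D
  h≡⇒≡ {d} {D} 1≤d d≤D (hD≤ , hD≢) hD≡hd with d ℕ.≟ D
  ... | yes d≡D = d≡D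
  ... | no  d≢D = ⊥-elim (hD≢ (antisym hD≤ (≡.subst (h (D ∸ 1) ≤ᴿ_) (≡.sym hD≡hd)
                                                 (antitone d (D ∸ 1) 1≤d (<⇒≤∸1 (≤∧≢⇒< d≤D d≢D))))))

  -- The overwritten entries h Δ come from ∑-updateAt, which avoids splitting Fin (Δ + 2).
  ∑h∘profile : ∀ ε {w x} → x ≢ w →
               (sum (h ∘ profile ε w x) +ᴿ h Δ) +ᴿ h Δ ≡ h (Δ ∸ ε) +ᴿ (h δ +ᴿ sum (h ∘ replicate (Δ + 2) Δ))
  ∑h∘profile ε {w} {x} x≢w = begin
    (sum (h ∘ profile ε w x) +ᴿ h Δ) +ᴿ h Δ
      ≡⟨ cong (λ d → (sum (h ∘ profile ε w x) +ᴿ h d) +ᴿ h Δ) (≡.sym (updateAt-minimal x w _ x≢w)) ⟩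
    (sum (h ∘ profile ε w x) +ᴿ h (almostRegular w x)) +ᴿ h Δ
      ≡⟨ cong (_+ᴿ h Δ) (∑-updateAt h (almostRegular w) x (const (Δ ∸ ε))) ⟩
    (h (Δ ∸ ε) +ᴿ sum (h ∘ almostRegular w)) +ᴿ h Δ
      ≡⟨ IsAbelianGroup.assoc isAbelianGroup _ _ _ ⟩
    h (Δ ∸ ε) +ᴿ (sum (h ∘ almostRegular w) +ᴿ h Δ)
      ≡⟨ cong (h (Δ ∸ ε) +ᴿ_) (∑-updateAt h (replicate (Δ + 2) Δ) w (const δ)) ⟩
    h (Δ ∸ ε) +ᴿ (h δ +ᴿ sum (h ∘ replicate (Δ + 2) Δ)) ∎
    where open ≡.≡-Reasoning

  ∑h∘profile-indep : ∀ ε {w x w′ x′} → x ≢ w → x′ ≢ w′ →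
                     sum (h ∘ profile ε w x) ≡ sum (h ∘ profile ε w′ x′)
  ∑h∘profile-indep ε x≢w x′≢w′ = +ᴿ-cancelʳ (h Δ) _ _ (+ᴿ-cancelʳ (h Δ) _ _
    (≡.trans (∑h∘profile ε x≢w) (≡.sym (∑h∘profile ε x′≢w′))))

  𝒥-𝒦 : ∀ {ε} → Parity δ ε → ∀ (K : Graph (Δ + 2)) → InK δ Δ K → ∀ {w x} → x ≢ w →
        𝒥 A h K ≡ sum (h ∘ profile ε w x)
  𝒥-𝒦 {ε} par K K∈𝒦 x≢w with InK⇒profile par K K∈𝒦
  ... | _ , _ , xK≢wK , degK≗ =
    ≡.trans (𝒥≡∑ K) (≡.trans (sum-cong-≗ (cong h ∘ degK≗)) (∑h∘profile-indep ε xK≢wK x≢w))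

  𝒦-minimal : ∀ {ε} → Parity δ ε → ∀ (G : Graph (Δ + 2)) → InK δ Δ G → Minimal A h δ Δ G
  𝒦-minimal {ε} par G G∈𝒦 Γ fam with dominated par Γ fam
  ... | w , x , x≢w , _ , dom = begin
    𝒥 A h G                  ≡⟨ 𝒥-𝒦 par G G∈𝒦 x≢w ⟩
    sum (h ∘ profile ε w x)  ≤⟨ ∑-mono-≤ (λ u → h-antitone-deg Γ fam u (dom u)) ⟩
    sum (h ∘ deg Γ)          ≡⟨ ≡.sym (𝒥≡∑ Γ) ⟩
    𝒥 A h Γ                  ∎
    where open ≤ᴿ-Reasoning

  minimal⇒𝒦 : ∀ {ε} → Parity δ ε → h Δ <ᴿ h (Δ ∸ 1) → h (Δ ∸ ε) <ᴿ h (Δ ∸ ε ∸ 1) →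
              ∀ (G : Graph (Δ + 2)) → InFamily δ Δ G → Minimal A h δ Δ G → InK δ Δ G
  minimal⇒𝒦 {ε} par dropΔ dropΔ∸ε G fam minimal
    with dominated par G fam | 𝒦-nonempty 1≤δ δ<Δ
  ... | w , x , x≢w , dw , dom | K , K∈𝒦 = profile⇒InK par G x≢w deg≗
    where
    ∑≤ : sum (h ∘ deg G) ≤ᴿ sum (h ∘ profile ε w x)
    ∑≤ = begin
      sum (h ∘ deg G)          ≡⟨ ≡.sym (𝒥≡∑ G) ⟩
      𝒥 A h G                  ≤⟨ minimal K (𝒦⊆𝔊 par K K∈𝒦) ⟩
      𝒥 A h K                  ≡⟨ 𝒥-𝒦 par K K∈𝒦 x≢w ⟩
      sum (h ∘ profile ε w x)  ∎
      where open ≤ᴿ-Reasoning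
    h≗ : h ∘ profile ε w x ≗ h ∘ deg G
    h≗ = ∑-squeeze (λ u → h-antitone-deg G fam u (dom u)) ∑≤
    drop : ∀ u → u ≢ w → h (profile ε w x u) <ᴿ h (profile ε w x u ∸ 1)
    drop u u≢w =
      profile-elim ε (λ d → h d <ᴿ h (d ∸ 1)) x≢w u (⊥-elim ∘ u≢w) (λ _ → dropΔ∸ε) (λ _ _ → dropΔ)
    deg≗ : deg G ≗ profile ε w x
    deg≗ u with u ≟ w
    ... | yes refl = ≡.trans dw (≡.sym (profile-at-w ε x≢w))
    ... | no  u≢w  = h≡⇒≡ (1≤deg G fam u) (dom u) (drop u u≢w) (h≗ u)

  drops : ∀ {ε} → Parity δ ε →
          (Even δ × h Δ <ᴿ h (Δ ∸ 1)) ⊎ (Odd δ × h (Δ ∸ 1) <ᴿ h (Δ ∸ 2) × h Δ <ᴿ h (Δ ∸ 1)) →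
          h Δ <ᴿ h (Δ ∸ 1) × h (Δ ∸ ε) <ᴿ h (Δ ∸ ε ∸ 1)
  drops (even _)   (inj₁ (_ , dropΔ))           = dropΔ , dropΔ
  drops (even 2∣δ) (inj₂ (2∤δ , _))             = ⊥-elim (2∤δ 2∣δ)
  drops (odd 2∤δ)  (inj₁ (2∣δ , _))             = ⊥-elim (2∤δ 2∣δ)
  drops (odd _)    (inj₂ (_ , dropΔ∸1 , dropΔ)) =
    dropΔ , ≡.subst (λ k → h (Δ ∸ 1) <ᴿ h k) (≡.sym (∸-+-assoc Δ 1 1)) dropΔ∸1

theorem2p13 : (A : OrdAbGroup) → (δ Δ : ℕ) → 1 ≤ δ → δ < Δ →
    (h : ℕ → OrdAbGroup.Carrier A) →
    PositiveOnℤ⁺ A h → NonIncrOnℤ⁺ A h →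
    ( (∀ (G : Graph (Δ + 2)) → InK δ Δ G →
          InFamily δ Δ G × Minimal A h δ Δ G)
    × ( ( (Even δ × OrdAbGroup._<ᴿ_ A (h Δ) (h (Δ ∸ 1)))
        ⊎ (Odd δ × OrdAbGroup._<ᴿ_ A (h (Δ ∸ 1)) (h (Δ ∸ 2))
                 × OrdAbGroup._<ᴿ_ A (h Δ) (h (Δ ∸ 1))) ) →
        ∀ (G : Graph (Δ + 2)) → InFamily δ Δ G →
          (Minimal A h δ Δ G ⇔ InK δ Δ G) ) )
theorem2p13 A δ Δ 1≤δ δ<Δ h _ antitone with parity δ
... | _ , par =
  (λ G G∈𝒦 → 𝒦⊆𝔊 par G G∈𝒦 , 𝒦-minimal par G G∈𝒦) ,
  (λ hyp G fam → let dropΔ , dropΔ∸ε = drops par hyp in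
                 mk⇔ (minimal⇒𝒦 par dropΔ dropΔ∸ε G fam) (𝒦-minimal par G))
  where
  open Minimality A 1≤δ δ<Δ h antitone
  open Profiles δ<Δ using (𝒦⊆𝔊)
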